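{- For every integer $n\ge 5$, $b_2(W_n)=\lceil\sqrt{n+6}\,\rceil$. Moreover, $b_2(W_4)=3$.
   Context: The wheel graph $W_n$ is obtained from the cycle $C_n$ by adding one central vertex adjacent to all $n$ vertices of the cycle (so $W_n$ has $n+1$ vertices). The 2-burning process: given a graph $G$ and a sequence $s=(s_1,\dots,s_m)$ of vertices of $G$ (sources), at round $0$ all vertices are uncolored; at each round $j\ge1$, (i) if $j\le m$ and $s_j$ is uncolored, $s_j$ is colored blue, and (ii) every uncolored vertex having at least two neighbors that were blue at the end of round $j-1$ is colored blue. $s$ is a 2-burning sequence if eventually all vertices are blue; $\mathrm{rd}(s)$ is the first round at the end of which all vertices are blue. $b_2(G)$ is the minimum of $\mathrm{rd}(s)$ over all 2-burning sequences for $G$. -}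

module Defs where

open import Data.Bool using (Bool; true; false; _∧_; _∨_; if_then_else_)
open import Data.Nat using (ℕ; zero; suc; _+_; _*_; _∸_; _≤_; _<_; _≡ᵇ_; _≤ᵇ_)
open import Data.Fin using (Fin; zero; suc; toℕ)
open import Data.Fin.Properties using () renaming (_≟_ to _≟F_)
open import Data.List using (List; []; _∷_; map; allFin)
open import Data.Nat.ListAction using (sum)
open import Data.Maybe using (Maybe; just; nothing)
open import Data.Product using (Σ; _×_)
open import Relation.Nullary using (¬_; does)
open import Relation.Binary.PropositionalEquality using (_≡_)

Graph : ℕ → Set
Graph N = Fin N → Fin N → Bool

nextC : ℕ → ℕ → ℕ
nextC n a = if suc a ≡ᵇ n then 0 else suc a

cycStep : (n : ℕ) → Fin n → Fin n → Bool
cycStep n i j = toℕ j ≡ᵇ nextC n (toℕ i)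

-- Wheel W_n on Fin (suc n): vertex zero is the centre, suc i is cycle vertex i.
wheel : (n : ℕ) → Graph (suc n)
wheel n zero    zero    = false
wheel n zero    (suc _) = true
wheel n (suc _) zero    = true
wheel n (suc i) (suc j) = cycStep n i j ∨ cycStep n j i

-- 0-indexed list access
nth : {A : Set} → List A → ℕ → Maybe A
nth []       _       = nothing
nth (x ∷ xs) zero    = just x
nth (x ∷ xs) (suc k) = nth xs k

-- is v the source s_j (1-indexed) of the sequence s?  (false if j > length s)
isSource : {N : ℕ} → List (Fin N) → ℕ → Fin N → Bool
isSource s zero    v = false
isSource s (suc k) v with nth s k
... | nothing = false
... | just u  = does (u ≟F v)

mutual
  -- blue G s j v : is v blue at the end of round j of the 2-burning process
  blue : {N : ℕ} → Graph N → List (Fin N) → ℕ → Fin N → Bool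
  blue G s zero    v = false
  blue G s (suc j) v =
    blue G s j v ∨ isSource s (suc j) v ∨ (2 ≤ᵇ blueNbrs G s j v)

  blueNbrs : {N : ℕ} → Graph N → List (Fin N) → ℕ → Fin N → ℕ
  blueNbrs {N} G s j v =
    sum (map (λ u → if G v u ∧ blue G s j u then 1 else 0) (allFin N))

AllBlue : {N : ℕ} → Graph N → List (Fin N) → ℕ → Set
AllBlue G s j = ∀ v → blue G s j v ≡ true

-- rd(s) = k : k is the first round at whose end all vertices are blue
-- (in particular s is a 2-burning sequence)
IsRd : {N : ℕ} → Graph N → List (Fin N) → ℕ → Set
IsRd G s k = AllBlue G s k × (∀ j → j < k → ¬ AllBlue G s j)

IsB2 : {N : ℕ} → Graph N → ℕ → Set
IsB2 {N} G k =
  Σ (List (Fin N)) (λ s → IsRd G s k) ×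
  (∀ (s : List (Fin N)) (r : ℕ) → IsRd G s r → k ≤ r)

IsCeilSqrt : ℕ → ℕ → Set
IsCeilSqrt m k = m ≤ k * k × (k ∸ 1) * (k ∸ 1) < m

{-# OPTIONS --safe #-}
-- Let T be the round in which the centre turns blue.  Before T a cycle vertex can
-- only turn blue as a source or when both of its cycle neighbours are blue, and those must then
-- be sources themselves; from T on the centre is a blue neighbour of every cycle vertex, so a blue
-- arc grows by one vertex at each end per round.  Hence at round r every cycle vertex lies within
-- distance r − max(i, T) of the source s_i, or lies between two sources placed before T and is
-- then adjacent to one of them.  These balls hold fewer than n vertices whenever 3 ≤ r and
-- r² < n + 6; the only delicate case is r = T = 3, where n ≥ 5 leaves room for just one vertex
-- between the two early sources.  For k = ⌈√(n + 6)⌉ cut the cycle into consecutive arcs of lengths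
-- 2 (k − max(i, 3)) + 1, i = 1, …, k, of total length k² − 6 ≥ n, and put s_i in the middle
-- of the i-th arc.  The first two sources burn the centre in round 3, after which every source
-- fills its arc by round k.
-- For W₄, the sources (centre, c₀, c₂) burn everything in three rounds, while two rounds
-- never burn more than two vertices.
module Submission where

open import Data.Bool using (Bool; true; false; _∧_; _∨_; if_then_else_)
open import Data.Bool.Properties using (T-≡; ∨-zeroʳ; ∧-zeroʳ)
open import Data.Empty using (⊥; ⊥-elim)
open import Data.Fin using (Fin; zero; suc; toℕ; fromℕ<)
open import Data.Fin.Properties using (toℕ-fromℕ<; toℕ-injective; toℕ<n; suc-injective; pigeonhole)
  renaming (_≟_ to _≟F_)
open import Data.List using (List; []; _∷_; length; _++_; concat; applyUpTo; tabulate; lookup; take)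
open import Data.List.Membership.Propositional using (_∈_)
open import Data.List.Membership.Propositional.Properties using (∈-concat⁺′; ∈-applyUpTo⁺)
open import Data.List.Properties using (length-++; map-tabulate; length-take)
open import Data.List.Relation.Unary.Any using (here; there; index)
open import Data.List.Relation.Unary.Any.Properties using (lookup-index)
open import Data.Maybe using (Maybe; just; nothing)
open import Data.Maybe.Properties using (just-injective)
open import Data.Nat using (ℕ; zero; suc; _+_; _*_; _∸_; _⊔_; _≤_; _<_; _≡ᵇ_; pred; z≤n; s≤s; _≤?_; _<?_)
open import Data.Nat.ListAction using (sum)
open import Data.Nat.Properties hiding (suc-injective)
open import Data.Nat.Tactic.RingSolver using (solve-∀)
open import Data.Product using (∃-syntax; _×_; _,_)
open import Data.Sum using (_⊎_; inj₁; inj₂; [_,_]′)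
open import Function using (_∘_; case_of_)
open import Function.Bundles using (Equivalence)
open import Relation.Binary.PropositionalEquality
open import Relation.Nullary using (¬_; yes; no; does)

open import Defs

-- Cycle arithmetic

nextC-wrap : ∀ {n a} → suc a ≡ n → nextC n a ≡ 0
nextC-wrap {n} {a} e with suc a ≡ᵇ n | ≡⇒≡ᵇ (suc a) n e
... | true | _ = refl

nextC-step : ∀ {n a} → suc a ≢ n → nextC n a ≡ suc a
nextC-step {n} {a} ne with suc a ≡ᵇ n | ≡ᵇ⇒≡ (suc a) n
... | true  | eq = ⊥-elim (ne (eq _))
... | false | _  = refl

nextC-< : ∀ {n a} → a < n → nextC n a < n
nextC-< {n} {a} a<n with suc a ≟ n
... | yes e  = subst (_< n) (sym (nextC-wrap e)) (≤-<-trans z≤n a<n)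
... | no  ne = subst (_< n) (sym (nextC-step ne)) (≤∧≢⇒< a<n ne)

prevC : ℕ → ℕ → ℕ
prevC n zero    = pred n
prevC n (suc a) = a

prevC-< : ∀ {n a} → a < n → prevC n a < n
prevC-< {suc n} {zero}  _   = ≤-refl
prevC-< {n}     {suc a} a<n = <-trans (n<1+n a) a<n

nextC-prevC : ∀ {n a} → a < n → nextC n (prevC n a) ≡ a
nextC-prevC {suc n} {zero}  _   = nextC-wrap refl
nextC-prevC {n}     {suc a} a<n = nextC-step (<⇒≢ a<n)

prevC-nextC : ∀ {n a} → a < n → prevC n (nextC n a) ≡ a
prevC-nextC {n} {a} a<n with suc a ≟ n
... | yes refl = cong (prevC (suc a)) (nextC-wrap {a = a} refl)
... | no ne    = cong (prevC n) (nextC-step ne)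

module _ {n : ℕ} where

  nextF : Fin n → Fin n
  nextF x = fromℕ< (nextC-< (toℕ<n x))

  prevF : Fin n → Fin n
  prevF x = fromℕ< (prevC-< (toℕ<n x))

  toℕ-nextF : (x : Fin n) → toℕ (nextF x) ≡ nextC n (toℕ x)
  toℕ-nextF x = toℕ-fromℕ< _

  nextF-prevF : (x : Fin n) → nextF (prevF x) ≡ x
  nextF-prevF x = toℕ-injective (begin
    toℕ (nextF (prevF x))        ≡⟨ toℕ-nextF (prevF x) ⟩
    nextC n (toℕ (prevF x))      ≡⟨ cong (nextC n) (toℕ-fromℕ< _) ⟩
    nextC n (prevC n (toℕ x))    ≡⟨ nextC-prevC (toℕ<n x) ⟩
    toℕ x                        ∎)
    where open ≡-Reasoning

  prevF-nextF : (x : Fin n) → prevF (nextF x) ≡ x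
  prevF-nextF x = toℕ-injective (begin
    toℕ (prevF (nextF x))        ≡⟨ toℕ-fromℕ< _ ⟩
    prevC n (toℕ (nextF x))      ≡⟨ cong (prevC n) (toℕ-nextF x) ⟩
    prevC n (nextC n (toℕ x))    ≡⟨ prevC-nextC (toℕ<n x) ⟩
    toℕ x                        ∎)
    where open ≡-Reasoning

  cycStep-nextF : (x : Fin n) → cycStep n x (nextF x) ≡ true
  cycStep-nextF x = Equivalence.to T-≡ (≡⇒≡ᵇ _ _ (toℕ-nextF x))

  cycStep⇒nextF : (x y : Fin n) → cycStep n x y ≡ true → y ≡ nextF x
  cycStep⇒nextF x y e = toℕ-injective (trans
    (≡ᵇ⇒≡ (toℕ y) _ (Equivalence.from T-≡ e)) (sym (toℕ-nextF x)))

  fwd : ℕ → Fin n → Fin n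
  fwd zero    x = x
  fwd (suc a) x = nextF (fwd a x)

  bwd : ℕ → Fin n → Fin n
  bwd zero    x = x
  bwd (suc a) x = prevF (bwd a x)

  fwd-+ : ∀ a b (x : Fin n) → fwd (a + b) x ≡ fwd a (fwd b x)
  fwd-+ zero    b x = refl
  fwd-+ (suc a) b x = cong nextF (fwd-+ a b x)

  fwd-comm : ∀ a b (x : Fin n) → fwd a (fwd b x) ≡ fwd b (fwd a x)
  fwd-comm a b x = begin
    fwd a (fwd b x)  ≡⟨ sym (fwd-+ a b x) ⟩
    fwd (a + b) x    ≡⟨ cong (λ c → fwd c x) (+-comm a b) ⟩
    fwd (b + a) x    ≡⟨ fwd-+ b a x ⟩
    fwd b (fwd a x)  ∎
    where open ≡-Reasoning

  bwd-suc-nextF : ∀ a (x : Fin n) → bwd (suc a) (nextF x) ≡ bwd a x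
  bwd-suc-nextF zero    x = prevF-nextF x
  bwd-suc-nextF (suc a) x = cong prevF (bwd-suc-nextF a x)

  bwd-fwd : ∀ a (x : Fin n) → bwd a (fwd a x) ≡ x
  bwd-fwd zero    x = refl
  bwd-fwd (suc a) x = trans (bwd-suc-nextF a (fwd a x)) (bwd-fwd a x)

  fwd-injective : ∀ a {x y : Fin n} → fwd a x ≡ fwd a y → x ≡ y
  fwd-injective a {x} {y} e = begin
    x                ≡⟨ sym (bwd-fwd a x) ⟩
    bwd a (fwd a x)  ≡⟨ cong (bwd a) e ⟩
    bwd a (fwd a y)  ≡⟨ bwd-fwd a y ⟩
    y                ∎
    where open ≡-Reasoning

module _ {m : ℕ} where

  toℕ-fwd-zero : ∀ a → a < suc m → toℕ (fwd a (zero {m})) ≡ a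
  toℕ-fwd-zero zero    _   = refl
  toℕ-fwd-zero (suc a) a<n = begin
    toℕ (nextF (fwd a zero))          ≡⟨ toℕ-nextF (fwd a zero) ⟩
    nextC (suc m) (toℕ (fwd a zero))  ≡⟨ cong (nextC (suc m)) (toℕ-fwd-zero a (<-trans (n<1+n a) a<n)) ⟩
    nextC (suc m) a                   ≡⟨ nextC-step (<⇒≢ a<n) ⟩
    suc a                             ∎
    where open ≡-Reasoning

  fwd-toℕ : (x : Fin (suc m)) → fwd (toℕ x) zero ≡ x
  fwd-toℕ x = toℕ-injective (toℕ-fwd-zero (toℕ x) (toℕ<n x))

-- Rotations commute and x = fwd (toℕ x) zero, so a fixed point of fwd a would make zero one too.
fwd-nofix : ∀ {n} a (x : Fin n) → 0 < a → a < n → fwd a x ≢ x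
fwd-nofix {suc m} a x 0<a a<n fix = <⇒≢ 0<a (sym (begin
  a                     ≡⟨ sym (toℕ-fwd-zero a a<n) ⟩
  toℕ (fwd a zero)      ≡⟨ cong toℕ (fwd-injective t zero-fixed) ⟩
  0                     ∎))
  where
  open ≡-Reasoning
  t = toℕ x
  zero-fixed : fwd t (fwd a zero) ≡ fwd t zero
  zero-fixed = begin
    fwd t (fwd a zero)  ≡⟨ fwd-comm t a zero ⟩
    fwd a (fwd t zero)  ≡⟨ cong (fwd a) (fwd-toℕ x) ⟩
    fwd a x             ≡⟨ fix ⟩
    x                   ≡⟨ sym (fwd-toℕ x) ⟩
    fwd t zero          ∎

module _ {n : ℕ} where

  InBall : Fin n → ℕ → Fin n → Set
  InBall c ρ x = ∃[ a ] a ≤ ρ × (x ≡ fwd a c ⊎ x ≡ bwd a c)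

  ball-centre : ∀ (c : Fin n) ρ → InBall c ρ c
  ball-centre c ρ = 0 , z≤n , inj₁ refl

  ball-mono : ∀ {c : Fin n} {ρ ρ′ x} → ρ ≤ ρ′ → InBall c ρ x → InBall c ρ′ x
  ball-mono ρ≤ρ′ (a , a≤ρ , e) = a , ≤-trans a≤ρ ρ≤ρ′ , e

  ball-zero : ∀ {c x : Fin n} → InBall c 0 x → x ≡ c
  ball-zero (zero , _ , inj₁ e) = e
  ball-zero (zero , _ , inj₂ e) = e

  ball-nextF : ∀ {c y : Fin n} {ρ} → InBall c ρ y → InBall c (suc ρ) (nextF y)
  ball-nextF (a     , a≤ρ , inj₁ refl) = suc a , s≤s a≤ρ , inj₁ refl
  ball-nextF (zero  , _   , inj₂ refl) = 1 , s≤s z≤n , inj₁ refl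
  ball-nextF (suc a , a<ρ , inj₂ refl) = a , m≤n⇒m≤1+n (<⇒≤ a<ρ) , inj₂ (nextF-prevF _)

  ball-prevF : ∀ {c y : Fin n} {ρ} → InBall c ρ y → InBall c (suc ρ) (prevF y)
  ball-prevF (a     , a≤ρ , inj₂ refl) = suc a , s≤s a≤ρ , inj₂ refl
  ball-prevF (zero  , _   , inj₁ refl) = 1 , s≤s z≤n , inj₂ refl
  ball-prevF (suc a , a<ρ , inj₁ refl) = a , m≤n⇒m≤1+n (<⇒≤ a<ρ) , inj₁ (prevF-nextF _)

  arc⊆ball : ∀ ρ a (y : Fin n) → a ≤ 2 * ρ → InBall (fwd ρ y) ρ (fwd a y)
  arc⊆ball ρ a y a≤2ρ with ρ ≤? a
  ... | yes ρ≤a = a ∸ ρ , m≤n+o⇒m∸n≤o a ρ a≤2ρ′ , inj₁ (begin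
    fwd a y                ≡⟨ cong (λ b → fwd b y) (sym (m∸n+n≡m ρ≤a)) ⟩
    fwd (a ∸ ρ + ρ) y      ≡⟨ fwd-+ (a ∸ ρ) ρ y ⟩
    fwd (a ∸ ρ) (fwd ρ y)  ∎)
    where
    open ≡-Reasoning
    a≤2ρ′ : a ≤ ρ + ρ
    a≤2ρ′ = subst (a ≤_) (cong (ρ +_) (+-identityʳ ρ)) a≤2ρ
  ... | no ρ≰a = ρ ∸ a , m∸n≤m ρ a , inj₂ (begin
    fwd a y                              ≡⟨ sym (bwd-fwd (ρ ∸ a) (fwd a y)) ⟩
    bwd (ρ ∸ a) (fwd (ρ ∸ a) (fwd a y))  ≡⟨ cong (bwd (ρ ∸ a)) (sym (fwd-+ (ρ ∸ a) a y)) ⟩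
    bwd (ρ ∸ a) (fwd (ρ ∸ a + a) y)      ≡⟨ cong (λ b → bwd (ρ ∸ a) (fwd b y)) (m∸n+n≡m (<⇒≤ (≰⇒> ρ≰a))) ⟩
    bwd (ρ ∸ a) (fwd ρ y)                ∎)
    where open ≡-Reasoning

  ballList : Fin n → ℕ → List (Fin n)
  ballList c zero    = c ∷ []
  ballList c (suc ρ) = fwd (suc ρ) c ∷ bwd (suc ρ) c ∷ ballList c ρ

  length-ballList : ∀ (c : Fin n) ρ → length (ballList c ρ) ≡ 2 * ρ + 1
  length-ballList c zero    = refl
  length-ballList c (suc ρ) = trans (cong (2 +_) (length-ballList c ρ))
                                    (cong (λ t → suc t + 1) (sym (+-suc ρ (ρ + 0))))

  ∈-ballList : ∀ {c x : Fin n} ρ → InBall c ρ x → x ∈ ballList c ρ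
  ∈-ballList zero    b = here (ball-zero b)
  ∈-ballList (suc ρ) (a , a≤ρ , e) with a ≟ suc ρ
  ... | yes refl = [ here , there ∘ here ]′ e
  ... | no  a≢ρ  = there (there (∈-ballList ρ (a , ≤-pred (≤∧≢⇒< a≤ρ a≢ρ) , e)))

∑< : ℕ → (ℕ → ℕ) → ℕ
∑< m f = sum (applyUpTo f m)

∑<-mono : ∀ m {f g : ℕ → ℕ} → (∀ i → i < m → f i ≤ g i) → ∑< m f ≤ ∑< m g
∑<-mono zero    f≤g = z≤n
∑<-mono (suc m) f≤g = +-mono-≤ (f≤g 0 (s≤s z≤n)) (∑<-mono m (λ i i<m → f≤g (suc i) (s≤s i<m)))

∑<-const : ∀ m c → ∑< m (λ _ → c) ≡ m * c
∑<-const zero    c = refl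
∑<-const (suc m) c = cong (c +_) (∑<-const m c)

∑<-+ : ∀ a b (f : ℕ → ℕ) → ∑< (a + b) f ≡ ∑< a f + ∑< b (λ i → f (a + i))
∑<-+ zero    b f = refl
∑<-+ (suc a) b f = trans (cong (f 0 +_) (∑<-+ a b (f ∘ suc))) (sym (+-assoc (f 0) _ _))

∑<-split-at : ∀ a b (f : ℕ → ℕ) → ∑< (a + suc b) f ≡ ∑< a f + (f a + ∑< b (λ i → f (a + suc i)))
∑<-split-at a b f =
  trans (∑<-+ a (suc b) f) (cong (λ t → ∑< a f + (f t + ∑< b (λ i → f (a + suc i)))) (+-identityʳ a))

∑<-odd : ∀ d → ∑< d (λ i → 2 * (d ∸ suc i) + 1) ≡ d * d
∑<-odd zero    = refl
∑<-odd (suc d) = begin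
  2 * d + 1 + ∑< d (λ i → 2 * (d ∸ suc i) + 1)  ≡⟨ cong (2 * d + 1 +_) (∑<-odd d) ⟩
  2 * d + 1 + d * d                              ≡⟨ odd+square d ⟩
  suc d * suc d                                  ∎
  where
  open ≡-Reasoning
  odd+square : ∀ d → 2 * d + 1 + d * d ≡ suc d * suc d
  odd+square = solve-∀

∑<-index : ∀ K (g : ℕ → ℕ) x → x < ∑< K g →
           ∃[ i ] ∃[ a ] i < K × a < g i × x ≡ ∑< i g + a
∑<-index (suc K) g x x<∑ with x <? g 0
... | yes x<g₀ = 0 , x , s≤s z≤n , x<g₀ , refl
... | no  x≮g₀ = shift (∑<-index K (g ∘ suc) (x ∸ g 0) (+-cancelˡ-< (g 0) _ _ x∸g₀<))
  where
  g₀≤x : g 0 ≤ x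
  g₀≤x = ≮⇒≥ x≮g₀
  x∸g₀< : g 0 + (x ∸ g 0) < g 0 + ∑< K (g ∘ suc)
  x∸g₀< = subst (_< _) (sym (m+[n∸m]≡n g₀≤x)) x<∑
  shift : ∃[ i ] ∃[ a ] i < K × a < g (suc i) × x ∸ g 0 ≡ ∑< i (g ∘ suc) + a →
          ∃[ i ] ∃[ a ] i < suc K × a < g i × x ≡ ∑< i g + a
  shift (i , a , i<K , a<g , e) = suc i , a , s≤s i<K , a<g , (begin
    x                           ≡⟨ sym (m+[n∸m]≡n g₀≤x) ⟩
    g 0 + (x ∸ g 0)             ≡⟨ cong (g 0 +_) e ⟩
    g 0 + (∑< i (g ∘ suc) + a)  ≡⟨ sym (+-assoc (g 0) _ a) ⟩
    ∑< (suc i) g + a            ∎)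
    where open ≡-Reasoning

length-concat-applyUpTo : ∀ {A : Set} m (F : ℕ → List A) →
                          length (concat (applyUpTo F m)) ≡ ∑< m (λ i → length (F i))
length-concat-applyUpTo zero    F = refl
length-concat-applyUpTo (suc m) F =
  trans (length-++ (F 0)) (cong (length (F 0) +_) (length-concat-applyUpTo m (F ∘ suc)))

sum-tabulate-zero : ∀ {N} (F : Fin N → ℕ) → (∀ y → F y ≡ 0) → sum (tabulate F) ≡ 0
sum-tabulate-zero {zero}  F F≡0 = refl
sum-tabulate-zero {suc N} F F≡0 = cong₂ _+_ (F≡0 zero) (sum-tabulate-zero (F ∘ suc) (F≡0 ∘ suc))

sum-tabulate-at : ∀ {N} (F : Fin N → ℕ) p → (∀ y → y ≢ p → F y ≡ 0) → sum (tabulate F) ≡ F p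
sum-tabulate-at {suc N} F zero    F≡0 =
  trans (cong (F zero +_) (sum-tabulate-zero (F ∘ suc) (λ y → F≡0 (suc y) (λ ())))) (+-identityʳ _)
sum-tabulate-at {suc N} F (suc p) F≡0 =
  cong₂ _+_ (F≡0 zero (λ ())) (sum-tabulate-at (F ∘ suc) p (λ y y≢p → F≡0 (suc y) (y≢p ∘ suc-injective)))

sum-tabulate-at₂ : ∀ {N} (F : Fin N → ℕ) p q → (∀ y → y ≢ p → y ≢ q → F y ≡ 0) →
                   sum (tabulate F) ≤ F p + F q
sum-tabulate-at₂ F zero    zero    F≡0 =
  ≤-trans (≤-reflexive (sum-tabulate-at F zero (λ y y≢0 → F≡0 y y≢0 y≢0))) (m≤m+n _ _)
sum-tabulate-at₂ F zero    (suc q) F≡0 = +-monoʳ-≤ (F zero) (≤-reflexive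
  (sum-tabulate-at (F ∘ suc) q (λ y y≢q → F≡0 (suc y) (λ ()) (y≢q ∘ suc-injective))))
sum-tabulate-at₂ F (suc p) zero    F≡0 = ≤-trans (+-monoʳ-≤ (F zero) (≤-reflexive
  (sum-tabulate-at (F ∘ suc) p (λ y y≢p → F≡0 (suc y) (y≢p ∘ suc-injective) (λ ())))))
  (≤-reflexive (+-comm (F zero) _))
sum-tabulate-at₂ F (suc p) (suc q) F≡0 rewrite F≡0 zero (λ ()) (λ ()) =
  sum-tabulate-at₂ (F ∘ suc) p q (λ y y≢p y≢q → F≡0 (suc y) (y≢p ∘ suc-injective) (y≢q ∘ suc-injective))

≤-sum-tabulate : ∀ {N} (F : Fin N → ℕ) p → F p ≤ sum (tabulate F)
≤-sum-tabulate F zero    = m≤m+n _ _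
≤-sum-tabulate F (suc p) = ≤-trans (≤-sum-tabulate (F ∘ suc) p) (m≤n+m _ _)

≤-sum-tabulate₂ : ∀ {N} (F : Fin N → ℕ) {p q} → p ≢ q → F p + F q ≤ sum (tabulate F)
≤-sum-tabulate₂ F {zero}  {zero}  p≢q = ⊥-elim (p≢q refl)
≤-sum-tabulate₂ F {zero}  {suc q} _   = +-monoʳ-≤ (F zero) (≤-sum-tabulate (F ∘ suc) q)
≤-sum-tabulate₂ F {suc p} {zero}  _   =
  ≤-trans (≤-reflexive (+-comm (F (suc p)) _)) (+-monoʳ-≤ (F zero) (≤-sum-tabulate (F ∘ suc) p))
≤-sum-tabulate₂ F {suc p} {suc q} p≢q =
  ≤-trans (≤-sum-tabulate₂ (F ∘ suc) (p≢q ∘ cong suc)) (m≤n+m _ _)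

complete⇒≤length : ∀ {N} (L : List (Fin N)) → (∀ v → v ∈ L) → N ≤ length L
complete⇒≤length {N} L ∈L with N ≤? length L
... | yes N≤ = N≤
... | no  N≰ with pigeonhole (≰⇒> N≰) (λ v → index (∈L v))
...   | i , j , i<j , same = ⊥-elim (<-irrefl (cong toℕ i≡j) i<j)
  where
  i≡j : i ≡ j
  i≡j = trans (lookup-index (∈L i)) (trans (cong (lookup L) same) (sym (lookup-index (∈L j))))

nth⇒∈take : ∀ {A : Set} (xs : List A) {k m v} → nth xs k ≡ just v → k < m → v ∈ take m xs
nth⇒∈take (x ∷ xs) {zero}  {suc m} refl _         = here refl
nth⇒∈take (x ∷ xs) {suc k} {suc m} e    (s≤s k<m) = there (nth⇒∈take xs e k<m)

nth-applyUpTo : ∀ {A : Set} (f : ℕ → A) {k i} → i < k → nth (applyUpTo f k) i ≡ just (f i)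
nth-applyUpTo f {suc k} {zero}  _         = refl
nth-applyUpTo f {suc k} {suc i} (s≤s i<k) = nth-applyUpTo (f ∘ suc) i<k

ind : Bool → ℕ
ind b = if b then 1 else 0

ind≤1 : ∀ b → ind b ≤ 1
ind≤1 true  = ≤-refl
ind≤1 false = z≤n

ind-∧-≤ : ∀ a b → ind (a ∧ b) ≤ ind b
ind-∧-≤ true  b = ≤-refl
ind-∧-≤ false b = z≤n

two-of-three : ∀ a b c → 2 ≤ ind a + (ind b + ind c) →
               (a ≡ true × (b ≡ true ⊎ c ≡ true)) ⊎ (a ≡ false × b ≡ true × c ≡ true)
two-of-three true  true  _     _           = inj₁ (refl , inj₁ refl)
two-of-three true  false true  _           = inj₁ (refl , inj₂ refl)
two-of-three true  false false (s≤s ())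
two-of-three false true  true  _           = inj₂ (refl , refl , refl)
two-of-three false true  false (s≤s ())
two-of-three false false true  (s≤s ())
two-of-three false false false ()

∨-≡-true : ∀ a {b} → a ∨ b ≡ true → a ≡ true ⊎ b ≡ true
∨-≡-true true  _ = inj₁ refl
∨-≡-true false e = inj₂ e

-- The 2-burning process

module Burning {N : ℕ} (G : Graph N) (s : List (Fin N)) where

  isSource⇒nth : ∀ j v → isSource s (suc j) v ≡ true → nth s j ≡ just v
  isSource⇒nth j v with nth s j
  ... | nothing = λ ()
  ... | just u with u ≟F v
  ...   | yes refl = λ _ → refl
  ...   | no  _    = λ ()

  nth⇒isSource : ∀ j v → nth s j ≡ just v → isSource s (suc j) v ≡ true
  nth⇒isSource j v e with nth s j
  nth⇒isSource j v refl | just .v with v ≟F v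
  ... | yes _   = refl
  ... | no  v≢v = ⊥-elim (v≢v refl)

  blue-inv : ∀ j v → blue G s (suc j) v ≡ true →
             blue G s j v ≡ true ⊎ nth s j ≡ just v ⊎ 2 ≤ blueNbrs G s j v
  blue-inv j v e with ∨-≡-true (blue G s j v) e
  ... | inj₁ b = inj₁ b
  ... | inj₂ e′ with ∨-≡-true (isSource s (suc j) v) e′
  ...   | inj₁ src = inj₂ (inj₁ (isSource⇒nth j v src))
  ...   | inj₂ two = inj₂ (inj₂ (≤ᵇ⇒≤ 2 _ (Equivalence.from T-≡ two)))

  blue-suc : ∀ j v → blue G s j v ≡ true → blue G s (suc j) v ≡ true
  blue-suc j v b rewrite b = refl

  blue-mono : ∀ {j j′} v → j ≤ j′ → blue G s j v ≡ true → blue G s j′ v ≡ true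
  blue-mono {j′ = zero}   v z≤n b = b
  blue-mono {j} {suc j′} v j≤ b with j ≟ suc j′
  ... | yes refl = b
  ... | no  j≢   = blue-suc j′ v (blue-mono v (≤-pred (≤∧≢⇒< j≤ j≢)) b)

  blue-source : ∀ j v → nth s j ≡ just v → blue G s (suc j) v ≡ true
  blue-source j v e rewrite nth⇒isSource j v e = ∨-zeroʳ (blue G s j v)

  blue-nbrs : ∀ j v → 2 ≤ blueNbrs G s j v → blue G s (suc j) v ≡ true
  blue-nbrs j v two rewrite Equivalence.to T-≡ (≤⇒≤ᵇ two) =
    trans (cong (blue G s j v ∨_) (∨-zeroʳ (isSource s (suc j) v))) (∨-zeroʳ (blue G s j v))

  blueNbrs-tabulate : ∀ j v → blueNbrs G s j v ≡ sum (tabulate (λ u → ind (G v u ∧ blue G s j u)))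
  blueNbrs-tabulate j v = cong sum (map-tabulate (λ u → u) (λ u → ind (G v u ∧ blue G s j u)))

  blueNbrs-0 : ∀ v → blueNbrs G s 0 v ≡ 0
  blueNbrs-0 v = trans (blueNbrs-tabulate 0 v) (sum-tabulate-zero _ (λ u → cong ind (∧-zeroʳ (G v u))))

  blue-1 : ∀ v → blue G s 1 v ≡ true → nth s 0 ≡ just v
  blue-1 v b with blue-inv 0 v b
  ... | inj₂ (inj₁ src) = src
  ... | inj₂ (inj₂ two) = ⊥-elim (<⇒≱ (s≤s z≤n) (subst (2 ≤_) (blueNbrs-0 v) two))

  blue-1-off : ∀ u → nth s 0 ≢ just u → blue G s 1 u ≡ false
  blue-1-off u not-source with blue G s 1 u in b
  ... | false = refl
  ... | true  = ⊥-elim (not-source (blue-1 u b))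

  blueNbrs-1 : ∀ v → blueNbrs G s 1 v ≤ 1
  blueNbrs-1 v = subst (_≤ 1) (sym (blueNbrs-tabulate 1 v)) (bound (nth s 0) refl)
    where
    F : Fin N → ℕ
    F u = ind (G v u ∧ blue G s 1 u)
    off : ∀ u → nth s 0 ≢ just u → F u ≡ 0
    off u not-source rewrite blue-1-off u not-source = cong ind (∧-zeroʳ (G v u))
    bound : ∀ m → nth s 0 ≡ m → sum (tabulate F) ≤ 1
    bound nothing  e =
      ≤-trans (≤-reflexive (sum-tabulate-zero F (λ u → off u (λ src → case trans (sym e) src of λ ())))) z≤n
    bound (just p) e = ≤-trans
      (≤-reflexive (sum-tabulate-at F p (λ u u≢p → off u (λ src → u≢p (just-injective (trans (sym src) e))))))
      (ind≤1 _)

  blue-2⇒∈take : ∀ v → blue G s 2 v ≡ true → v ∈ take 2 s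
  blue-2⇒∈take v b with blue-inv 1 v b
  ... | inj₁ b₁         = nth⇒∈take s (blue-1 v b₁) (s≤s z≤n)
  ... | inj₂ (inj₁ src) = nth⇒∈take s src (s≤s (s≤s z≤n))
  ... | inj₂ (inj₂ two) = ⊥-elim (<⇒≱ ≤-refl (≤-trans two (blueNbrs-1 v)))

  2≤blueNbrs⇒2≤round : ∀ j v → 2 ≤ blueNbrs G s j v → 2 ≤ j
  2≤blueNbrs⇒2≤round zero          v two = ⊥-elim (<⇒≱ (s≤s z≤n) (subst (2 ≤_) (blueNbrs-0 v) two))
  2≤blueNbrs⇒2≤round (suc zero)    v two = ⊥-elim (<⇒≱ ≤-refl (≤-trans two (blueNbrs-1 v)))
  2≤blueNbrs⇒2≤round (suc (suc j)) v _   = s≤s (s≤s z≤n)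

  allBlue-2 : AllBlue G s 2 → N ≤ 2
  allBlue-2 all = ≤-trans (complete⇒≤length (take 2 s) (λ v → blue-2⇒∈take v (all v)))
                          (≤-trans (≤-reflexive (length-take 2 s)) (m⊓n≤m 2 _))

open Burning

IsB2-intro : ∀ {N} {G : Graph N} {r} (s : List (Fin N)) →
             AllBlue G s (suc r) → (∀ s′ → ¬ AllBlue G s′ r) → IsB2 G (suc r)
IsB2-intro {G = G} {r} s all none = (s , all , too-early s) , minimal
  where
  too-early : ∀ s′ j → j < suc r → ¬ AllBlue G s′ j
  too-early s′ j j≤r all′ = none s′ (λ v → blue-mono G s′ v (≤-pred j≤r) (all′ v))
  minimal : ∀ s′ r′ → IsRd G s′ r′ → suc r ≤ r′
  minimal s′ r′ (all′ , _) with suc r ≤? r′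
  ... | yes r<r′ = r<r′
  ... | no  r≮r′ = ⊥-elim (too-early s′ r′ (≰⇒> r≮r′) all′)

module _ {n : ℕ} where

  wheel-adjacent : ∀ (x y : Fin n) → y ≡ nextF x ⊎ y ≡ prevF x → wheel n (suc x) (suc y) ≡ true
  wheel-adjacent x _ (inj₁ refl) rewrite cycStep-nextF x = refl
  wheel-adjacent x _ (inj₂ refl)
    rewrite subst (λ z → cycStep n (prevF x) z ≡ true) (nextF-prevF x) (cycStep-nextF (prevF x)) = ∨-zeroʳ _

  wheel-nonadjacent : ∀ (x y : Fin n) → y ≢ nextF x → y ≢ prevF x → wheel n (suc x) (suc y) ≡ false
  wheel-nonadjacent x y y≢next y≢prev with cycStep n x y in xy | cycStep n y x in yx
  ... | true  | _     = ⊥-elim (y≢next (cycStep⇒nextF x y xy))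
  ... | false | true  = ⊥-elim (y≢prev (trans (sym (prevF-nextF y)) (cong prevF (sym (cycStep⇒nextF y x yx)))))
  ... | false | false = refl

module Wheel {n : ℕ} (s : List (Fin (suc n))) where

  bl : ℕ → Fin (suc n) → Bool
  bl = blue (wheel n) s

  blueNbrs-cycle-≤ : ∀ j x → blueNbrs (wheel n) s j (suc x) ≤
                     ind (bl j zero) + (ind (bl j (suc (nextF x))) + ind (bl j (suc (prevF x))))
  blueNbrs-cycle-≤ j x rewrite blueNbrs-tabulate (wheel n) s j (suc x) = +-monoʳ-≤ (ind (bl j zero))
    (≤-trans (sum-tabulate-at₂ F (nextF x) (prevF x) off)
             (+-mono-≤ (ind-∧-≤ (wheel n (suc x) (suc (nextF x))) _) (ind-∧-≤ (wheel n (suc x) (suc (prevF x))) _)))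
    where
    F : Fin n → ℕ
    F y = ind (wheel n (suc x) (suc y) ∧ bl j (suc y))
    off : ∀ y → y ≢ nextF x → y ≢ prevF x → F y ≡ 0
    off y y≢next y≢prev rewrite wheel-nonadjacent x y y≢next y≢prev = refl

  blue-along-cycle : ∀ j x y → bl j zero ≡ true → bl j (suc y) ≡ true → y ≡ nextF x ⊎ y ≡ prevF x →
                     bl (suc j) (suc x) ≡ true
  blue-along-cycle j x y centre y-blue adj =
    blue-nbrs (wheel n) s j (suc x) (subst (2 ≤_) (sym (blueNbrs-tabulate (wheel n) s j (suc x))) two≤)
    where
    F : Fin n → ℕ
    F y = ind (wheel n (suc x) (suc y) ∧ bl j (suc y))
    Fy≡1 : F y ≡ 1
    Fy≡1 rewrite wheel-adjacent x y adj | y-blue = refl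
    two≤ : 2 ≤ ind (bl j zero) + sum (tabulate F)
    two≤ rewrite centre = s≤s (subst (_≤ sum (tabulate F)) Fy≡1 (≤-sum-tabulate F y))

  centre-blue : ∀ j p q → p ≢ q → bl j (suc p) ≡ true → bl j (suc q) ≡ true → bl (suc j) zero ≡ true
  centre-blue j p q p≢q p-blue q-blue =
    blue-nbrs (wheel n) s j zero (subst (2 ≤_) (sym (blueNbrs-tabulate (wheel n) s j zero)) two≤)
    where
    F : Fin n → ℕ
    F y = ind (bl j (suc y))
    two≤ : 2 ≤ sum (tabulate F)
    two≤ = subst (_≤ sum (tabulate F)) (cong₂ (λ a b → ind a + ind b) p-blue q-blue) (≤-sum-tabulate₂ F p≢q)

  blue-ball : ∀ t c ρ {x} → bl t zero ≡ true → bl t (suc c) ≡ true → InBall c ρ x → bl (t + ρ) (suc x) ≡ true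
  blue-ball t c ρ centre c-blue (a , a≤ρ , e) =
    blue-mono (wheel n) s (suc _) (+-monoʳ-≤ t a≤ρ) ([ fwd-blue a , bwd-blue a ]′ e)
    where
    centre-at : ∀ a → bl (t + a) zero ≡ true
    centre-at a = blue-mono (wheel n) s zero (m≤m+n t a) centre
    step : ∀ a {x} y → bl (t + a) (suc y) ≡ true → y ≡ nextF x ⊎ y ≡ prevF x → bl (t + suc a) (suc x) ≡ true
    step a {x} y y-blue adj = subst (λ j → bl j (suc x) ≡ true) (sym (+-suc t a))
      (blue-along-cycle (t + a) x y (centre-at a) y-blue adj)
    fwd-blue : ∀ a {x} → x ≡ fwd a c → bl (t + a) (suc x) ≡ true
    fwd-blue zero    refl = subst (λ j → bl j (suc c) ≡ true) (sym (+-identityʳ t)) c-blue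
    fwd-blue (suc a) refl = step a (fwd a c) (fwd-blue a refl) (inj₂ (sym (prevF-nextF _)))
    bwd-blue : ∀ a {x} → x ≡ bwd a c → bl (t + a) (suc x) ≡ true
    bwd-blue zero    refl = fwd-blue zero refl
    bwd-blue (suc a) refl = step a (bwd a c) (bwd-blue a refl) (inj₁ (sym (nextF-prevF _)))

-- Lower bound

cyclePiece : ∀ {n} {A : Set} → (Fin n → List A) → Maybe (Fin (suc n)) → List A
cyclePiece P (just (suc c)) = P c
cyclePiece P (just zero)    = []
cyclePiece P nothing        = []

length-cyclePiece-≤ : ∀ {n} {A : Set} {P : Fin n → List A} {B} →
                      (∀ c → length (P c) ≤ B) → ∀ m → length (cyclePiece P m) ≤ B
length-cyclePiece-≤ P≤B (just (suc c)) = P≤B c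
length-cyclePiece-≤ P≤B (just zero)    = z≤n
length-cyclePiece-≤ P≤B nothing        = z≤n

first-true : (f : ℕ → Bool) → (∀ {i j} → i ≤ j → f i ≡ true → f j ≡ true) → ∀ r → f r ≡ true →
             ∃[ t ] (∀ j → j < t → f j ≡ false) × (∀ j → t ≤ j → f j ≡ true)
first-true f mono zero    e = 0 , (λ _ ()) , (λ _ 0≤j → mono 0≤j e)
first-true f mono (suc r) e with f r in e′
... | true  = first-true f mono r e′
... | false = suc r , off , (λ _ r<j → mono r<j e)
  where
  off : ∀ j → j < suc r → f j ≡ false
  off j j≤r with f j in e″
  ... | false = refl
  ... | true  = case trans (sym e′) (mono (≤-pred j≤r) e″) of λ ()

module Covering {n : ℕ} (s : List (Fin (suc n))) (T : ℕ)
  (centre-off : ∀ j → j < T → blue (wheel n) s j zero ≡ false)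
  (centre-on : ∀ j → T ≤ j → blue (wheel n) s j zero ≡ true)
  (prevF≢nextF : ∀ (x : Fin n) → prevF x ≢ nextF x) where

  open Wheel s

  -- Source k c: the source of round k + 1 is the cycle vertex c.  It spreads from round
  -- max(k + 1, T) on, so by round j it has covered the ball of radius j − max(k + 1, T).
  Source : ℕ → Fin n → Set
  Source k c = nth s k ≡ just (suc c)

  EarlySource : Fin n → Set
  EarlySource c = ∃[ k ] suc k < T × Source k c

  radius : ℕ → ℕ → ℕ
  radius j k = j ∸ (suc k ⊔ T)

  Grown : ℕ → Fin n → Set
  Grown j x = ∃[ k ] ∃[ c ] Source k c × k < j × InBall c (radius j k) x

  Pinched : ℕ → Fin n → Set
  Pinched j x = T ≤ j × EarlySource (prevF x) × EarlySource (nextF x)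

  Covered : ℕ → Fin n → Set
  Covered j x = Grown j x ⊎ Pinched j x

  centre-on⇒T≤ : ∀ {j} → bl j zero ≡ true → T ≤ j
  centre-on⇒T≤ {j} on with T ≤? j
  ... | yes T≤j = T≤j
  ... | no  T≰j = case trans (sym on) (centre-off j (≰⇒> T≰j)) of λ ()

  centre-off⇒<T : ∀ {j} → bl j zero ≡ false → j < T
  centre-off⇒<T {j} off with j <? T
  ... | yes j<T = j<T
  ... | no  j≮T = case trans (sym off) (centre-on j (≮⇒≥ j≮T)) of λ ()

  covered-suc : ∀ {j x} → Covered j x → Covered (suc j) x
  covered-suc {j} (inj₁ (k , c , src , k<j , ball)) =
    inj₁ (k , c , src , m≤n⇒m≤1+n k<j , ball-mono (∸-monoˡ-≤ (suc k ⊔ T) (n≤1+n j)) ball)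
  covered-suc (inj₂ (T≤j , early)) = inj₂ (m≤n⇒m≤1+n T≤j , early)

  covered⇒early : ∀ {j y} → j < T → Covered j y → EarlySource y
  covered⇒early {j} {y} j<T (inj₁ (k , c , src , k<j , ball)) =
    k , ≤-<-trans k<j j<T ,
    subst (Source k) (sym (ball-zero (subst (λ ρ → InBall c ρ y) radius≡0 ball))) src
    where
    radius≡0 : radius j k ≡ 0
    radius≡0 = m≤n⇒m∸n≡0 (≤-trans (<⇒≤ j<T) (m≤n⊔m (suc k) T))
  covered⇒early j<T (inj₂ (T≤j , _)) = ⊥-elim (<⇒≱ j<T T≤j)

  covered-nbr : ∀ {j x y} → T ≤ j → Covered j y → y ≡ nextF x ⊎ y ≡ prevF x → Covered (suc j) x
  covered-nbr {j} {x} {y} T≤j (inj₁ (k , c , src , k<j , ball)) adj =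
    inj₁ (k , c , src , m≤n⇒m≤1+n k<j ,
          subst (λ ρ → InBall c ρ x) (sym (+-∸-assoc 1 (⊔-lub k<j T≤j))) (grow adj))
    where
    grow : y ≡ nextF x ⊎ y ≡ prevF x → InBall c (suc (radius j k)) x
    grow (inj₁ refl) = subst (InBall c _) (prevF-nextF x) (ball-prevF ball)
    grow (inj₂ refl) = subst (InBall c _) (nextF-prevF x) (ball-nextF ball)
  covered-nbr {x = x} T≤j (inj₂ (_ , (k , k<T , src) , _)) (inj₁ refl) =
    inj₁ (k , _ , src , ≤-trans (<⇒≤ k<T) (m≤n⇒m≤1+n T≤j) , 0 , z≤n , inj₁ (sym (prevF-nextF x)))
  covered-nbr {x = x} T≤j (inj₂ (_ , _ , (k , k<T , src))) (inj₂ refl) =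
    inj₁ (k , _ , src , ≤-trans (<⇒≤ k<T) (m≤n⇒m≤1+n T≤j) , 0 , z≤n , inj₁ (sym (nextF-prevF x)))

  blue⇒covered : ∀ j x → bl j (suc x) ≡ true → Covered j x
  blue⇒covered (suc j) x b with blue-inv (wheel n) s j (suc x) b
  ... | inj₁ b′         = covered-suc (blue⇒covered j x b′)
  ... | inj₂ (inj₁ src) = inj₁ (j , x , src , ≤-refl , ball-centre x _)
  ... | inj₂ (inj₂ two) with two-of-three (bl j zero) (bl j (suc (nextF x))) (bl j (suc (prevF x)))
                                          (≤-trans two (blueNbrs-cycle-≤ j x))
  ...   | inj₁ (on , inj₁ next-blue) = covered-nbr (centre-on⇒T≤ on) (blue⇒covered j _ next-blue) (inj₁ refl)
  ...   | inj₁ (on , inj₂ prev-blue) = covered-nbr (centre-on⇒T≤ on) (blue⇒covered j _ prev-blue) (inj₂ refl)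
  ...   | inj₂ (off , next-blue , prev-blue) =
    inj₂ (centre-on⇒T≤ (centre-blue j _ _ (prevF≢nextF x) prev-blue next-blue) ,
          covered⇒early (centre-off⇒<T off) (blue⇒covered j _ prev-blue) ,
          covered⇒early (centre-off⇒<T off) (blue⇒covered j _ next-blue))

  -- Covering lists: the source of round k + 1 contributes P k c if it is the cycle vertex c,
  -- and nothing if it is the centre.
  piece : (ℕ → Fin n → List (Fin n)) → ℕ → List (Fin n)
  piece P k = cyclePiece (P k) (nth s k)

  sourcePieces : (ℕ → Fin n → List (Fin n)) → ℕ → List (Fin n)
  sourcePieces P r = concat (applyUpTo (piece P) r)

  ∈-sourcePieces : ∀ P {r k c x} → Source k c → k < r → x ∈ P k c → x ∈ sourcePieces P r
  ∈-sourcePieces P {k = k} {x = x} src k<r x∈ =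
    ∈-concat⁺′ (subst (λ m → x ∈ cyclePiece (P k) m) (sym src) x∈) (∈-applyUpTo⁺ (piece P) k<r)

  length-piece-≤ : ∀ P k {B} → (∀ c → Source k c → length (P k c) ≤ B) → length (piece P k) ≤ B
  length-piece-≤ P k {B} bound = go (nth s k) refl
    where
    go : ∀ m → nth s k ≡ m → length (cyclePiece (P k) m) ≤ B
    go (just (suc c)) e = bound c e
    go (just zero)    _ = z≤n
    go nothing        _ = z≤n

  length-piece-centre : ∀ P k → nth s k ≡ just zero → length (piece P k) ≤ 0
  length-piece-centre P k centre = length-piece-≤ P k (λ c src → case trans (sym centre) src of λ ())

  length-sourcePieces : ∀ P r → length (sourcePieces P r) ≡ ∑< r (λ k → length (piece P k))
  length-sourcePieces P r = length-concat-applyUpTo r (piece P)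

  Source-unique : ∀ {k c c′} → Source k c → Source k c′ → c ≡ c′
  Source-unique src src′ = suc-injective (just-injective (trans (sym src) src′))

late-centre-square : ∀ t D →
  t * (2 * D + 1) + (0 + D * D) + (t * t + t + 2 * D + 1) ≡ (t + suc D) * (t + suc D)
late-centre-square = solve-∀

late-square : ∀ t D →
  t * (2 * D + 1) + ((2 * D + 1) + D * D) + (t * t + t) ≡ (t + suc D) * (t + suc D)
late-square = solve-∀

on-time-centre-square : ∀ t → t * 2 + (0 + 0) + (t * t + 1) ≡ (t + 1) * (t + 1)
on-time-centre-square = solve-∀

on-time-square : ∀ u → suc u * 2 + (2 + 0) + (u * u + 2 * u) ≡ (suc u + 1) * (suc u + 1)
on-time-square = solve-∀

prevF≢nextF : ∀ {n} → 3 ≤ n → (x : Fin n) → prevF x ≢ nextF x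
prevF≢nextF 3≤n x e = fwd-nofix 2 (prevF x) (s≤s z≤n) 3≤n (trans (cong nextF (nextF-prevF x)) (sym e))

midpoint : ∀ {n} → Fin n → Fin n → Fin n
midpoint a b = if does (nextF (nextF a) ≟F b) then nextF a else nextF b

-- Both orientations at once would give fwd 4 a ≡ a.
midpoint-unique : ∀ {n} → (∀ (y : Fin n) → fwd 4 y ≢ y) → ∀ {x a b : Fin n} →
                  (prevF x ≡ a × nextF x ≡ b) ⊎ (prevF x ≡ b × nextF x ≡ a) → x ≡ midpoint a b
midpoint-unique _ {x} (inj₁ (refl , refl)) with nextF (nextF (prevF x)) ≟F nextF x
... | yes _   = sym (nextF-prevF x)
... | no  ne  = ⊥-elim (ne (cong nextF (nextF-prevF x)))
midpoint-unique fwd⁴≢id {x} (inj₂ (refl , refl)) with nextF (nextF (nextF x)) ≟F prevF x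
... | yes e = ⊥-elim (fwd⁴≢id (prevF x) (trans (cong (λ y → nextF (nextF (nextF y))) (nextF-prevF x)) e))
... | no  _ = sym (nextF-prevF x)

module Counting {n : ℕ} (n≥5 : 5 ≤ n) (s : List (Fin (suc n))) (T′ : ℕ)
  (centre-off : ∀ j → j < suc T′ → blue (wheel n) s j zero ≡ false)
  (centre-on : ∀ j → suc T′ ≤ j → blue (wheel n) s j zero ≡ true)
  (r : ℕ) (3≤r : 3 ≤ r) (r²≤ : r * r ≤ n + 5) (all-blue : AllBlue (wheel n) s r) where

  3≤n : 3 ≤ n
  3≤n = ≤-trans (s≤s (s≤s (s≤s z≤n))) n≥5

  open Covering s (suc T′) centre-off centre-on (prevF≢nextF 3≤n)

  -- Bounds on the lengths of the covering lists of Late and OnTime below: each length falls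
  -- short of r² by at least 6, except in a few small cases where it is at most 4.

  <-of-square-slack : ∀ {a} r e → a + e ≡ r * r → r * r ≤ n + 5 → 6 ≤ e → a < n
  <-of-square-slack {a} r e eq r²≤ 6≤e = +-cancelʳ-≤ 5 (suc a) n (begin
    suc a + 5  ≡⟨ sym (+-suc a 5) ⟩
    a + 6      ≤⟨ +-monoʳ-≤ a 6≤e ⟩
    a + e      ≡⟨ eq ⟩
    r * r      ≤⟨ r²≤ ⟩
    n + 5      ∎)
    where open ≤-Reasoning

  6≤t²+t : ∀ {t} → 2 ≤ t → 6 ≤ t * t + t
  6≤t²+t 2≤t = +-mono-≤ (*-mono-≤ 2≤t 2≤t) 2≤t

  late-centre-count : ∀ t D → 1 ≤ D → 3 ≤ t + suc D → (t + suc D) * (t + suc D) ≤ n + 5 →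
                      t * (2 * D + 1) + (0 + D * D) < n
  late-centre-count zero (suc zero) _ (s≤s (s≤s ())) _
  late-centre-count zero (suc (suc zero)) _ _ _ = n≥5
  late-centre-count (suc zero) (suc zero) _ _ _ = n≥5
  late-centre-count t@zero D@(suc (suc (suc _))) _ _ r²≤ =
    <-of-square-slack (t + suc D) _ (late-centre-square t D) r²≤
      (≤-trans (*-monoʳ-≤ 2 (s≤s (s≤s (s≤s z≤n)))) (m≤m+n _ 1))
  late-centre-count t@(suc zero) D@(suc (suc _)) _ _ r²≤ =
    <-of-square-slack (t + suc D) _ (late-centre-square t D) r²≤
      (s≤s (s≤s (≤-trans (*-monoʳ-≤ 2 (s≤s (s≤s z≤n))) (m≤m+n _ 1))))
  late-centre-count t@(suc (suc _)) D _ _ r²≤ =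
    <-of-square-slack (t + suc D) _ (late-centre-square t D) r²≤
      (≤-trans (6≤t²+t {t} (s≤s (s≤s z≤n))) (≤-trans (m≤m+n _ (2 * D)) (m≤m+n _ 1)))

  late-count : ∀ t D → 2 ≤ t → (t + suc D) * (t + suc D) ≤ n + 5 →
               t * (2 * D + 1) + ((2 * D + 1) + D * D) < n
  late-count t D 2≤t r²≤ = <-of-square-slack (t + suc D) _ (late-square t D) r²≤ (6≤t²+t 2≤t)

  on-time-centre-count : ∀ t → 2 ≤ t → (t + 1) * (t + 1) ≤ n + 5 → t * 2 + (0 + 0) < n
  on-time-centre-count (suc zero) (s≤s ()) _
  on-time-centre-count (suc (suc zero)) _ _ = n≥5
  on-time-centre-count t@(suc (suc (suc _))) _ r²≤ =
    <-of-square-slack (t + 1) _ (on-time-centre-square t) r²≤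
      (≤-trans (≤-trans (m≤m+n 6 3) 9≤t²) (m≤m+n _ 1))
    where
    9≤t² : 3 * 3 ≤ t * t
    9≤t² = *-mono-≤ {3} {t} (s≤s (s≤s (s≤s z≤n))) (s≤s (s≤s (s≤s z≤n)))

  on-time-count : ∀ t → 3 ≤ t → (t + 1) * (t + 1) ≤ n + 5 → t * 2 + (2 + 0) < n
  on-time-count (suc u) (s≤s 2≤u) r²≤ = <-of-square-slack (suc u + 1) _ (on-time-square u) r²≤
    (≤-trans (m≤m+n 6 2) (+-mono-≤ (*-mono-≤ 2≤u 2≤u) (*-monoʳ-≤ 2 2≤u)))

  covered : ∀ x → Covered r x
  covered x = blue⇒covered r x (all-blue (suc x))

  T≤r : suc T′ ≤ r
  T≤r = centre-on⇒T≤ (all-blue zero)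

  early<r : ∀ {k} → suc k < suc T′ → k < r
  early<r k<T = ≤-trans (n≤1+n _) (≤-trans k<T T≤r)

  too-short : (L : List (Fin n)) → (∀ x → x ∈ L) → length L < n → ⊥
  too-short L ∈L short = <⇒≱ short (complete⇒≤length L ∈L)

  centre-source-or-late : nth s T′ ≡ just zero ⊎ 2 ≤ T′
  centre-source-or-late with blue-inv (wheel n) s T′ zero (centre-on (suc T′) ≤-refl)
  ... | inj₁ b          = case trans (sym b) (centre-off T′ ≤-refl) of λ ()
  ... | inj₂ (inj₁ src) = inj₁ src
  ... | inj₂ (inj₂ two) = inj₂ (2≤blueNbrs⇒2≤round (wheel n) s T′ zero two)

  module Late (D : ℕ) (1≤D : 1 ≤ D) (r≡ : r ≡ T′ + suc D) where

    early-radius : ∀ k → k ≤ T′ → radius r k ≡ D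
    early-radius k k≤T′ rewrite m≤n⇒m⊔n≡n (s≤s k≤T′) | r≡ =
      trans (cong (_∸ suc T′) (+-suc T′ D)) (m+n∸m≡n T′ D)

    late-radius : ∀ i → radius r (T′ + suc i) ≡ D ∸ suc i
    late-radius i rewrite m≥n⇒m⊔n≡m (s≤s (m≤m+n T′ (suc i))) | r≡ =
      trans (cong (T′ + suc D ∸_) (sym (+-suc T′ (suc i)))) ([m+n]∸[m+o]≡n∸o T′ (suc D) (suc (suc i)))

    ballPiece : ℕ → Fin n → List (Fin n)
    ballPiece k c = ballList c (radius r k)

    complete : ∀ x → x ∈ sourcePieces ballPiece r
    complete x with covered x
    ... | inj₁ (k , c , src , k<r , ball) = ∈-sourcePieces ballPiece src k<r (∈-ballList _ ball)
    ... | inj₂ (_ , (k , k<T , src) , _)  = ∈-sourcePieces ballPiece src (early<r k<T) (∈-ballList _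
      (1 , subst (1 ≤_) (sym (early-radius k (≤-pred (<⇒≤ k<T)))) 1≤D , inj₁ (sym (nextF-prevF x))))

    ℓ : ℕ → ℕ
    ℓ k = length (piece ballPiece k)

    ℓ≤ : ∀ k → ℓ k ≤ 2 * radius r k + 1
    ℓ≤ k = length-piece-≤ ballPiece k (λ c _ → ≤-reflexive (length-ballList c (radius r k)))

    length≤ : ∀ b → ℓ T′ ≤ b → length (sourcePieces ballPiece r) ≤ T′ * (2 * D + 1) + (b + D * D)
    length≤ b ℓT′≤b = begin
      length (sourcePieces ballPiece r)                 ≡⟨ length-sourcePieces ballPiece r ⟩
      ∑< r ℓ                                            ≡⟨ cong (λ m → ∑< m ℓ) r≡ ⟩
      ∑< (T′ + suc D) ℓ                                 ≡⟨ ∑<-split-at T′ D ℓ ⟩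
      ∑< T′ ℓ + (ℓ T′ + ∑< D (λ i → ℓ (T′ + suc i)))  ≤⟨ +-mono-≤ early (+-mono-≤ ℓT′≤b late) ⟩
      T′ * (2 * D + 1) + (b + D * D)                    ∎
      where
      open ≤-Reasoning
      early : ∑< T′ ℓ ≤ T′ * (2 * D + 1)
      early = ≤-trans
        (∑<-mono T′ (λ k k<T′ → subst (λ ρ → ℓ k ≤ 2 * ρ + 1) (early-radius k (<⇒≤ k<T′)) (ℓ≤ k)))
        (≤-reflexive (∑<-const T′ _))
      late : ∑< D (λ i → ℓ (T′ + suc i)) ≤ D * D
      late = ≤-trans
        (∑<-mono D (λ i _ → subst (λ ρ → ℓ (T′ + suc i) ≤ 2 * ρ + 1) (late-radius i) (ℓ≤ (T′ + suc i))))
        (≤-reflexive (∑<-odd D))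

    absurd : ⊥
    absurd with centre-source-or-late
    ... | inj₁ centre = too-short _ complete (≤-<-trans
            (length≤ 0 (length-piece-centre ballPiece T′ centre))
            (late-centre-count T′ D 1≤D (subst (3 ≤_) r≡ 3≤r) (subst (λ m → m * m ≤ n + 5) r≡ r²≤)))
    ... | inj₂ 2≤T′   = too-short _ complete (≤-<-trans
            (length≤ (2 * D + 1) (subst (λ ρ → ℓ T′ ≤ 2 * ρ + 1) (early-radius T′ ≤-refl) (ℓ≤ T′)))
            (late-count T′ D 2≤T′ (subst (λ m → m * m ≤ n + 5) r≡ r²≤)))

  module OnTime (r≡ : r ≡ T′ + 1) where

    at-source : ∀ {k} {c x : Fin n} → k < r → InBall c (radius r k) x → x ≡ c
    at-source {k} {c} {x} k<r ball = ball-zero (subst (λ ρ → InBall c ρ x) radius≡0 ball)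
      where
      radius≡0 : radius r k ≡ 0
      radius≡0 = m≤n⇒m∸n≡0 (≤-trans (≤-reflexive (trans r≡ (+-comm T′ 1))) (m≤n⊔m (suc k) (suc T′)))

    sum≤ : ∀ P b B → length (piece P T′) ≤ b → (∀ k c → length (P k c) ≤ B) →
           length (sourcePieces P r) ≤ T′ * B + (b + 0)
    sum≤ P b B ℓT′≤b ℓ≤B = begin
      length (sourcePieces P r)                     ≡⟨ length-sourcePieces P r ⟩
      ∑< r ℓ                                        ≡⟨ cong (λ m → ∑< m ℓ) r≡ ⟩
      ∑< (T′ + 1) ℓ                                 ≡⟨ ∑<-split-at T′ 0 ℓ ⟩
      ∑< T′ ℓ + (ℓ T′ + 0)
        ≤⟨ +-monoˡ-≤ _ (∑<-mono T′ (λ k _ → length-piece-≤ P k (λ c _ → ℓ≤B k c))) ⟩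
      ∑< T′ (λ _ → B) + (ℓ T′ + 0)
        ≤⟨ +-mono-≤ (≤-reflexive (∑<-const T′ B)) (+-monoˡ-≤ 0 ℓT′≤b) ⟩
      T′ * B + (b + 0)                              ∎
      where
      open ≤-Reasoning
      ℓ : ℕ → ℕ
      ℓ k = length (piece P k)

    pairPiece : ℕ → Fin n → List (Fin n)
    pairPiece k c = c ∷ nextF c ∷ []

    pairs-complete : ∀ x → x ∈ sourcePieces pairPiece r
    pairs-complete x with covered x
    ... | inj₁ (k , c , src , k<r , ball) = ∈-sourcePieces pairPiece src k<r (here (at-source k<r ball))
    ... | inj₂ (_ , (k , k<T , src) , _)  =
      ∈-sourcePieces pairPiece src (early<r k<T) (there (here (sym (nextF-prevF x))))

    fwd⁴≢id : ∀ (y : Fin n) → fwd 4 y ≢ y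
    fwd⁴≢id y = fwd-nofix 4 y (s≤s z≤n) n≥5

    -- For T = 3 only the sources of rounds 1 and 2 are early, and at most one vertex lies between them.
    midPiece : ℕ → Fin n → List (Fin n)
    midPiece zero    c = c ∷ cyclePiece (λ b → midpoint c b ∷ []) (nth s 1)
    midPiece (suc k) c = c ∷ []

    mids-complete : T′ ≡ 2 → ∀ x → x ∈ sourcePieces midPiece r
    mids-complete T′≡2 x with covered x
    ... | inj₁ (zero  , c , src , k<r , ball) = ∈-sourcePieces midPiece src k<r (here (at-source k<r ball))
    ... | inj₁ (suc k , c , src , k<r , ball) = ∈-sourcePieces midPiece src k<r (here (at-source k<r ball))
    ... | inj₂ (_ , (k₁ , k₁<T , src₁) , (k₂ , k₂<T , src₂)) =
      between k₁ k₂ (subst (suc k₁ <_) (cong suc T′≡2) k₁<T) (subst (suc k₂ <_) (cong suc T′≡2) k₂<T) src₁ src₂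
      where
      mid∈ : ∀ {a b} → Source 0 a → Source 1 b → x ≡ midpoint a b → x ∈ sourcePieces midPiece r
      mid∈ {a} src₀ src₁ x≡ = ∈-sourcePieces midPiece src₀ (≤-trans (s≤s z≤n) 3≤r)
        (there (subst (λ m → x ∈ cyclePiece (λ b → midpoint a b ∷ []) m) (sym src₁) (here x≡)))
      between : ∀ k₁ k₂ → suc k₁ < 3 → suc k₂ < 3 → Source k₁ (prevF x) → Source k₂ (nextF x) →
                x ∈ sourcePieces midPiece r
      between 0 1 _ _ prev next = mid∈ prev next (midpoint-unique fwd⁴≢id (inj₁ (refl , refl)))
      between 1 0 _ _ prev next = mid∈ next prev (midpoint-unique fwd⁴≢id (inj₂ (refl , refl)))
      between 0 0 _ _ prev next = ⊥-elim (prevF≢nextF 3≤n x (Source-unique prev next))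
      between 1 1 _ _ prev next = ⊥-elim (prevF≢nextF 3≤n x (Source-unique prev next))
      between (suc (suc _)) _ (s≤s (s≤s (s≤s ()))) _ _ _
      between _ (suc (suc _)) _ (s≤s (s≤s (s≤s ()))) _ _

    mids-length : T′ ≡ 2 → length (sourcePieces midPiece r) ≤ 4
    mids-length refl = begin
      length (sourcePieces midPiece r)  ≡⟨ length-sourcePieces midPiece r ⟩
      ∑< r ℓ                            ≡⟨ cong (λ m → ∑< m ℓ) r≡ ⟩
      ℓ 0 + (ℓ 1 + (ℓ 2 + 0))           ≤⟨ +-mono-≤ ℓ₀≤2 (+-mono-≤ (ℓ≤1 0) (+-mono-≤ (ℓ≤1 1) ≤-refl)) ⟩
      4                                 ∎
      where
      open ≤-Reasoning
      ℓ : ℕ → ℕ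
      ℓ k = length (piece midPiece k)
      ℓ₀≤2 : ℓ 0 ≤ 2
      ℓ₀≤2 = length-piece-≤ midPiece 0 (λ c _ → s≤s (length-cyclePiece-≤ (λ _ → ≤-refl) (nth s 1)))
      ℓ≤1 : ∀ k → ℓ (suc k) ≤ 1
      ℓ≤1 k = length-piece-≤ midPiece (suc k) (λ _ _ → ≤-refl)

    absurd : ⊥
    absurd with centre-source-or-late
    ... | inj₁ centre = too-short _ pairs-complete (≤-<-trans
            (sum≤ pairPiece 0 2 (length-piece-centre pairPiece T′ centre) (λ _ _ → ≤-refl))
            (on-time-centre-count T′ (≤-pred (subst (3 ≤_) (trans r≡ (+-comm T′ 1)) 3≤r))
                                     (subst (λ m → m * m ≤ n + 5) r≡ r²≤)))
    ... | inj₂ 2≤T′ with T′ ≟ 2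
    ...   | yes T′≡2 = too-short _ (mids-complete T′≡2) (≤-<-trans (mids-length T′≡2) n≥5)
    ...   | no  T′≢2 = too-short _ pairs-complete (≤-<-trans
            (sum≤ pairPiece 2 2 (length-piece-≤ pairPiece T′ (λ _ _ → ≤-refl)) (λ _ _ → ≤-refl))
            (on-time-count T′ (≤∧≢⇒< 2≤T′ (T′≢2 ∘ sym)) (subst (λ m → m * m ≤ n + 5) r≡ r²≤)))

  absurd : ⊥
  absurd with m≤n⇒m<n∨m≡n T≤r
  ... | inj₂ T≡r = OnTime.absurd (trans (sym T≡r) (+-comm 1 T′))
  ... | inj₁ T<r = Late.absurd (r ∸ suc T′) (m<n⇒0<n∸m T<r) (sym (trans (+-suc T′ _) (m+[n∸m]≡n T≤r)))

no-burning-before : ∀ {n} → 5 ≤ n → ∀ r → 3 ≤ r → r * r < n + 6 →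
                    (s : List (Fin (suc n))) → ¬ AllBlue (wheel n) s r
no-burning-before {n} n≥5 r 3≤r r²< s all-blue
  with first-true (λ j → blue (wheel n) s j zero) (blue-mono (wheel n) s zero) r (all-blue zero)
... | zero   , _   , on = case on 0 z≤n of λ ()
... | suc T′ , off , on =
  Counting.absurd n≥5 s T′ off on r 3≤r (≤-pred (subst (r * r <_) (+-suc n 5) r²<)) all-blue

-- Upper bound

odd<of-square : ∀ {n m} → 1 ≤ m → (2 + m) * (2 + m) < n + 6 → 2 * m + 1 + 0 < n
odd<of-square {n} {suc m′} _ lt = +-cancelʳ-≤ 6 _ n
  (≤-trans (≤-trans (m≤m+n _ (m′ * m′ + 4 * m′)) (≤-reflexive (sym (square-split m′)))) lt)
  where
  square-split : ∀ m′ → suc ((2 + suc m′) * (2 + suc m′)) ≡ suc (2 * suc m′ + 1 + 0) + 6 + (m′ * m′ + 4 * m′)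
  square-split = solve-∀

module Construction {n′ m : ℕ} (1≤m : 1 ≤ m)
  (n+6≤k² : suc n′ + 6 ≤ (3 + m) * (3 + m)) ([k-1]²<n+6 : (2 + m) * (2 + m) < suc n′ + 6) where

  n k : ℕ
  n = suc n′
  k = 3 + m

  -- Source i (placed in round i + 1) spreads from round max(i + 1, 3) on, reaching radius R i
  -- by round k.
  R : ℕ → ℕ
  R i = k ∸ (suc i ⊔ 3)

  width : ℕ → ℕ
  width i = 2 * R i + 1

  -- Arc i starts at position ∑< i width and has length width i; source i sits in its middle.
  pos : ℕ → Fin n
  pos i = fwd (R i) (fwd (∑< i width) zero)

  s : List (Fin (suc n))
  s = applyUpTo (λ i → suc (pos i)) k

  open Wheel s

  source-blue : ∀ {i} → i < k → bl (suc i) (suc (pos i)) ≡ true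
  source-blue {i} i<k = blue-source (wheel n) s i (suc (pos i)) (nth-applyUpTo (λ i → suc (pos i)) i<k)

  width₀<n : ∑< 1 width < n
  width₀<n = odd<of-square 1≤m [k-1]²<n+6

  pos₀≢pos₁ : pos 0 ≢ pos 1
  pos₀≢pos₁ e = fwd-nofix (∑< 1 width) (pos 0) (≤-trans (m≤n+m 1 (2 * m)) (m≤m+n _ 0)) width₀<n
    (trans (fwd-comm (∑< 1 width) m zero) (sym e))

  centre-blue-3 : bl 3 zero ≡ true
  centre-blue-3 = centre-blue 2 (pos 0) (pos 1) pos₀≢pos₁
    (blue-suc (wheel n) s 1 (suc (pos 0)) (source-blue (s≤s z≤n))) (source-blue (s≤s (s≤s z≤n)))

  n≤∑width : n ≤ ∑< k width
  n≤∑width = +-cancelʳ-≤ 6 n _ (begin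
    n + 6                                                  ≤⟨ n+6≤k² ⟩
    (3 + m) * (3 + m)                                      ≡⟨ square-as-arcs m ⟩
    2 * m + 1 + (2 * m + 1 + (2 * m + 1 + 0)) + m * m + 6  ≡⟨ cong (_+ 6) (sym ∑width) ⟩
    ∑< k width + 6                                         ∎)
    where
    open ≤-Reasoning
    ∑width : ∑< k width ≡ 2 * m + 1 + (2 * m + 1 + (2 * m + 1 + 0)) + m * m
    ∑width = trans (∑<-+ 3 m width) (cong (∑< 3 width +_) (∑<-odd m))
    square-as-arcs : ∀ m → (3 + m) * (3 + m) ≡ 2 * m + 1 + (2 * m + 1 + (2 * m + 1 + 0)) + m * m + 6
    square-as-arcs = solve-∀

  in-some-ball : ∀ x → ∃[ i ] i < k × InBall (pos i) (R i) x
  in-some-ball x with ∑<-index k width (toℕ x) (<-≤-trans (toℕ<n x) n≤∑width)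
  ... | i , a , i<k , a<width , x≡ =
    i , i<k , subst (InBall (pos i) (R i)) x-on-arc
                    (arc⊆ball (R i) a _ (≤-pred (subst (a <_) (+-comm _ 1) a<width)))
    where
    x-on-arc : fwd a (fwd (∑< i width) zero) ≡ x
    x-on-arc = begin
      fwd a (fwd (∑< i width) zero) ≡⟨ sym (fwd-+ a _ zero) ⟩
      fwd (a + ∑< i width) zero     ≡⟨ cong (λ b → fwd b zero) (trans (+-comm a _) (sym x≡)) ⟩
      fwd (toℕ x) zero              ≡⟨ fwd-toℕ x ⟩
      x                             ∎
      where open ≡-Reasoning

  all-blue : AllBlue (wheel n) s k
  all-blue zero    = blue-mono (wheel n) s {3} {k} zero (m≤m+n 3 m) centre-blue-3
  all-blue (suc x) = blue-from-ball (in-some-ball x)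
    where
    blue-from-ball : ∃[ i ] i < k × InBall (pos i) (R i) x → bl k (suc x) ≡ true
    blue-from-ball (i , i<k , ball) = subst (λ j → bl j (suc x) ≡ true) (m+[n∸m]≡n t≤k)
      (blue-ball t (pos i) (R i) (blue-mono (wheel n) s {3} zero (m≤n⊔m (suc i) 3) centre-blue-3)
                                 (blue-mono (wheel n) s (suc (pos i)) (m≤m⊔n (suc i) 3) (source-blue i<k)) ball)
      where
      t : ℕ
      t = suc i ⊔ 3
      t≤k : t ≤ k
      t≤k = ⊔-lub i<k (s≤s (s≤s (s≤s z≤n)))

4≤ceil√ : ∀ {n k} → 5 ≤ n → IsCeilSqrt (n + 6) k → 4 ≤ k
4≤ceil√ {n} {k} n≥5 (n+6≤k² , _) with 4 ≤? k
... | yes 4≤k = 4≤k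
... | no  4≰k = ⊥-elim (<⇒≱ k²<n+6 n+6≤k²)
  where
  k≤3 : k ≤ 3
  k≤3 = ≤-pred (≰⇒> 4≰k)
  k²<n+6 : k * k < n + 6
  k²<n+6 = ≤-trans (s≤s (*-mono-≤ k≤3 k≤3)) (≤-trans (m≤m+n 10 1) (+-monoˡ-≤ 6 n≥5))

b₂-wheel : ∀ n → 5 ≤ n → ∀ k → IsCeilSqrt (n + 6) k → IsB2 (wheel n) k
b₂-wheel n n≥5 k ceil with 4≤ceil√ {n} {k} n≥5 ceil
b₂-wheel (suc n′) n≥5 (suc (suc (suc (suc m′)))) (n+6≤k² , [k-1]²<n+6) | s≤s (s≤s (s≤s (s≤s _))) =
  IsB2-intro s all-blue (λ s′ → no-burning-before n≥5 (3 + m′) (m≤m+n 3 m′) [k-1]²<n+6 s′)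
  where open Construction {n′} {suc m′} (s≤s z≤n) n+6≤k² [k-1]²<n+6

b₂-wheel₄ : IsB2 (wheel 4) 3
b₂-wheel₄ = IsB2-intro sources all-blue (λ s′ → <⇒≱ (s≤s (s≤s (s≤s z≤n))) ∘ allBlue-2 (wheel 4) s′)
  where
  sources : List (Fin 5)
  sources = zero ∷ suc zero ∷ suc (suc (suc zero)) ∷ []
  all-blue : AllBlue (wheel 4) sources 3
  all-blue zero                         = refl
  all-blue (suc zero)                   = refl
  all-blue (suc (suc zero))             = refl
  all-blue (suc (suc (suc zero)))       = refl
  all-blue (suc (suc (suc (suc zero)))) = refl

theorem3 : ((n : ℕ) → 5 ≤ n → (k : ℕ) → IsCeilSqrt (n + 6) k → IsB2 (wheel n) k)
           × IsB2 (wheel 4) 3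
theorem3 = b₂-wheel , b₂-wheel₄
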